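{- Let $q\ge 10$ be an integer with $q\equiv 2$ or $q\equiv 3 \pmod 4$, and let $\ell=\binom{q}{2}$. For every integer $k\ge 1$ and $n=(\ell+1)^k$, there exists a completely balanced edge-coloring of $K_n$ with $\ell$ colors that contains no rainbow $K_q$; that is, $d(n,K_q)=\infty$.
   Context: $K_n$ denotes the complete graph on $n$ vertices. An edge-coloring of $K_n$ using a set $C$ of $\ell$ colors, where $\ell$ divides $n-1$, is completely balanced if every vertex is incident to exactly $(n-1)/\ell$ edges of each color of $C$. A subgraph is rainbow if all its edges receive distinct colors. An $(\ell,d)$-coloring of $K_n$ is an edge-coloring using exactly $\ell$ colors in total such that every vertex is incident to at least $d$ edges of every color. For a graph $F$ with $\ell$ edges, $d(n,F)=\infty$ if $K_n$ has an $(\ell,\lfloor (n-1)/\ell\rfloor)$-coloring without a rainbow copy of $F$; otherwise $d(n,F)$ is the smallest integer $d$ such that every $(\ell,d)$-coloring of $K_n$ contains a rainbow copy of $F$. -}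

module Defs where

open import Data.Nat using (ℕ; zero; suc; _+_; _*_; _∸_; _^_; _<_)
open import Data.Nat.Combinatorics using (_C_)
open import Data.Fin using (Fin; toℕ; _≟_)
open import Data.Fin.Properties using () renaming (_≟_ to _≟F_)
open import Data.List using (List; length; filter; allFin)
open import Data.Product using (_×_; Σ; ∃; ∃-syntax; _,_)
open import Relation.Nullary using (¬_; yes; no)
open import Relation.Nullary.Decidable using (_×-dec_; ¬?)
open import Relation.Binary.PropositionalEquality using (_≡_; _≢_)
open import Function.Definitions using (Injective)

-- An edge-colouring of K_n with colours from Fin ℓ: a symmetric function on
-- ordered pairs of vertices; its values on the diagonal are irrelevant.
record EdgeColoring (n ℓ : ℕ) : Set where
  field
    col : Fin n → Fin n → Fin ℓ
    sym : ∀ u v → col u v ≡ col v u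
open EdgeColoring public

colorDegree : ∀ {n ℓ} → EdgeColoring n ℓ → Fin n → Fin ℓ → ℕ
colorDegree {n} c v a =
  length (filter (λ u → ¬? (u ≟F v) ×-dec (col c v u ≟F a)) (allFin n))

-- completely balanced: ℓ divides n-1 and each vertex meets exactly
-- (n-1)/ℓ edges of each colour (stated multiplicatively: ℓ * d = n - 1)
CompletelyBalanced : ∀ {n ℓ} → EdgeColoring n ℓ → Set
CompletelyBalanced {n} {ℓ} c =
  Σ ℕ λ d → (ℓ * d ≡ n ∸ 1) × (∀ v a → colorDegree c v a ≡ d)

RainbowClique : ∀ {n ℓ} → EdgeColoring n ℓ → ℕ → Set
RainbowClique {n} c q =
  Σ (Fin q → Fin n) λ f → Injective _≡_ _≡_ f ×
    (∀ i j i' j' → toℕ i < toℕ j → toℕ i' < toℕ j' →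
       col c (f i) (f j) ≡ col c (f i') (f j') → (i ≡ i') × (j ≡ j'))

-- Let ℓ = 2s + 1. Colouring the edge {a, b} of K_(ℓ+1) on ℤ/ℓ ∪ {∞} by a + b, and {a, ∞} by 2a,
-- gives a one-factorization: every vertex meets every colour exactly once. Its lexicographic powers
-- (replace each vertex by a copy of the previous power and colour the edges between two copies like
-- the edge between their indices) are completely balanced. A rainbow clique in such a power lies in
-- one copy or meets every copy at most once, because two vertices of one copy and a vertex outside it
-- span two edges of the same colour; so it suffices that the one-factorization has no rainbow K_q.
-- Dropping ∞ from a rainbow K_q there leaves p = q - 1 residues with distinct pairwise sums. Their
-- ordered differences x_i - x_j are then distinct, apart from the p diagonal pairs and the at most 2p
-- pairs for which x_j is the midpoint of an edge at x_i. Hence p² ≤ 3p + ℓ, which fails for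
-- ℓ = C(q, 2) as soon as q ≥ 9. Finally C(q, 2) is odd when q ≡ 2, 3 (mod 4).

module Submission where

open import Defs hiding (sym)
open import Data.Nat using (ℕ; _≥_; _^_; _+_; _%_)
open import Data.Nat.Combinatorics using (_C_)
open import Data.Product using (Σ; _×_)
open import Data.Sum using (_⊎_)
open import Relation.Nullary using (¬_)
open import Relation.Binary.PropositionalEquality using (_≡_)

open import Data.Empty using (⊥-elim)
open import Data.Fin
  using (Fin; zero; suc; toℕ; punchIn; punchOut; _↑ˡ_; _↑ʳ_; combine; remQuot; quotient; remainder; _<?_)
open import Data.Fin.Properties
  using (_≟_; suc-injective; toℕ-injective; toℕ<n; toℕ-fromℕ<; ¬Fin0; <-cmp; <-asym; any?; injective⇒≤;
         punchIn-injective; punchInᵢ≢i; punchIn-punchOut; punchOut-injective;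
         combine-injective; combine-remQuot; remQuot-combine)
open import Data.List using (length; filter; tabulate)
open import Data.Nat using (zero; suc; _*_; _∸_; _/_; _≤_; z≤n; s≤s; NonZero; >-nonZero)
open import Data.Nat.Combinatorics using (nCk+nC[k+1]≡[n+1]C[k+1]; nC1≡n)
open import Data.Nat.DivMod
  using (_mod_; m≡m%n+[m/n]*n; %-distribˡ-+; %-distribˡ-*; [m+kn]%n≡m%n; [m+n]%n≡m%n; m<n⇒m%n≡m)
open import Data.Nat.Properties
  using (+-*-semiring; +-assoc; +-comm; +-identityʳ; +-mono-≤; +-monoʳ-≤; +-cancelʳ-≤;
         *-comm; *-assoc; *-identityˡ; *-identityʳ; *-zeroʳ; *-distribˡ-+; *-cancelˡ-≡; *-cancelʳ-≤;
         ≤-refl; ≤-trans; ≤-reflexive; ≤-antisym; <⇒≤; <⇒≱; ≮⇒≥; 1+n≰n; m∸n+n≡m; n≤1+n;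
         module ≤-Reasoning)
open import Data.Nat.Tactic.RingSolver using (solve-∀)
open import Algebra.Properties.Semiring.Sum +-*-semiring
  using (sum; sum-remove; sum-cong-≗; sum-replicate-zero; ∑-distrib-+; *-distribʳ-sum)
open import Data.Product using (∃; _,_; proj₁; proj₂; uncurry)
import Data.Product as Product
open import Data.Sum using (inj₁; inj₂; [_,_]′)
import Data.Sum as Sum
open import Function using (_∘_; id)
open import Function.Definitions using (Injective)
open import Level using (Level)
open import Relation.Binary.Definitions using (tri<; tri≈; tri>)
open import Relation.Binary.PropositionalEquality
  using (_≢_; refl; sym; trans; cong; cong₂; module ≡-Reasoning)
open import Relation.Nullary using (Dec; yes; no)
open import Relation.Nullary.Decidable using (_×-dec_; ¬?)
open import Relation.Nullary.Negation using (contradiction)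
open import Relation.Unary using (Pred; Decidable)
open import Relation.Unary.Properties using (_∪?_)

private
  variable
    a p q : Level
    P Q : Set p

∑-mono-≤ : ∀ {n} {f g : Fin n → ℕ} → (∀ i → f i ≤ g i) → sum f ≤ sum g
∑-mono-≤ {zero}  f≤g = z≤n
∑-mono-≤ {suc n} f≤g = +-mono-≤ (f≤g zero) (∑-mono-≤ (f≤g ∘ suc))

∑-const : ∀ n c → sum {n} (λ _ → c) ≡ n * c
∑-const zero    c = refl
∑-const (suc n) c = cong (c +_) (∑-const n c)

∑-single : ∀ {n} {f : Fin n → ℕ} i → (∀ j → j ≢ i → f j ≡ 0) → sum f ≡ f i
∑-single {suc n} {f} i vanish = begin
  sum f                              ≡⟨ sum-remove f ⟩
  f i + sum (f ∘ punchIn i)          ≡⟨ cong (f i +_) (sum-cong-≗ (λ j → vanish _ (punchInᵢ≢i i j))) ⟩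
  f i + sum {n} (λ _ → 0)            ≡⟨ cong (f i +_) (sum-replicate-zero n) ⟩
  f i + 0                            ≡⟨ +-identityʳ (f i) ⟩
  f i                                ∎
  where open ≡-Reasoning

∑-↑ : ∀ m {n} (f : Fin (m + n) → ℕ) → sum f ≡ sum (λ i → f (i ↑ˡ n)) + sum (λ j → f (m ↑ʳ j))
∑-↑ zero    f = refl
∑-↑ (suc m) f = trans (cong (f zero +_) (∑-↑ m (f ∘ suc))) (sym (+-assoc (f zero) _ _))

∑-combine : ∀ m {n} (f : Fin (m * n) → ℕ) →
            sum f ≡ sum (λ i → sum (λ j → f (combine {m} {n} i j)))
∑-combine zero        f = refl
∑-combine (suc m) {n} f =
  trans (∑-↑ n f) (cong (sum (λ j → f (j ↑ˡ (m * n))) +_) (∑-combine m (λ k → f (n ↑ʳ k))))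

indicator : Dec P → ℕ
indicator (yes _) = 1
indicator (no _)  = 0

indicator-mono : (P → Q) → (P? : Dec P) (Q? : Dec Q) → indicator P? ≤ indicator Q?
indicator-mono P⇒Q (yes P) (yes _) = ≤-refl
indicator-mono P⇒Q (yes P) (no ¬Q) = contradiction (P⇒Q P) ¬Q
indicator-mono P⇒Q (no _)  _       = z≤n

indicator-cong : (P → Q) → (Q → P) → (P? : Dec P) (Q? : Dec Q) → indicator P? ≡ indicator Q?
indicator-cong P⇒Q Q⇒P P? Q? = ≤-antisym (indicator-mono P⇒Q P? Q?) (indicator-mono Q⇒P Q? P?)

indicator-yes : (P? : Dec P) → P → indicator P? ≡ 1
indicator-yes (yes _) _ = refl
indicator-yes (no ¬P) P = contradiction P ¬P

indicator-no : (P? : Dec P) → ¬ P → indicator P? ≡ 0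
indicator-no (yes P) ¬P = contradiction P ¬P
indicator-no (no _)  _  = refl

count : ∀ {n} {P : Pred (Fin n) p} → Decidable P → ℕ
count P? = sum (λ i → indicator (P? i))

length-filter-tabulate : ∀ {A : Set a} {n} {P : Pred A p} (P? : Decidable P) (f : Fin n → A) →
                         length (filter P? (tabulate f)) ≡ count (P? ∘ f)
length-filter-tabulate {n = zero}  P? f = refl
length-filter-tabulate {n = suc n} P? f with P? (f zero)
... | yes _ = cong suc (length-filter-tabulate P? (f ∘ suc))
... | no  _ = length-filter-tabulate P? (f ∘ suc)

module _ {n} {P : Pred (Fin n) p} (P? : Decidable P) where

  count-cong : {Q : Pred (Fin n) q} (Q? : Decidable Q) →
               (∀ i → P i → Q i) → (∀ i → Q i → P i) → count P? ≡ count Q?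
  count-cong Q? P⊆Q Q⊆P = sum-cong-≗ (λ i → indicator-cong (P⊆Q i) (Q⊆P i) (P? i) (Q? i))

  count-∪ : {Q : Pred (Fin n) q} (Q? : Decidable Q) → count (P? ∪? Q?) ≤ count P? + count Q?
  count-∪ Q? = ≤-trans (∑-mono-≤ pointwise) (≤-reflexive (∑-distrib-+ {n} _ _))
    where
    pointwise : ∀ i → indicator ((P? ∪? Q?) i) ≤ indicator (P? i) + indicator (Q? i)
    pointwise i with P? i | Q? i
    ... | yes _ | _     = s≤s z≤n
    ... | no _  | yes _ = ≤-refl
    ... | no _  | no _  = z≤n

  count-universal : (∀ i → P i) → count P? ≡ n
  count-universal all = trans (sum-cong-≗ (λ i → indicator-yes (P? i) (all i)))
                              (trans (∑-const n 1) (*-identityʳ n))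

  count-unique : ∀ i → P i → (∀ j → P j → j ≡ i) → count P? ≡ 1
  count-unique i Pi unique =
    trans (∑-single i (λ j j≢i → indicator-no (P? j) (j≢i ∘ unique j))) (indicator-yes (P? i) Pi)

count-const : ∀ n (Q? : Dec Q) → count {n = n} {P = λ _ → Q} (λ _ → Q?) ≡ n * indicator Q?
count-const n Q? = ∑-const n (indicator Q?)

count-≤-injection : ∀ {n m} {P : Pred (Fin n) p} (P? : Decidable P) (f : ∀ {i} → P i → Fin m) →
                    (∀ {i j} (Pi : P i) (Pj : P j) → f Pi ≡ f Pj → i ≡ j) → count P? ≤ m
count-≤-injection {n = zero}  P? f f-inj = z≤n
count-≤-injection {n = suc n} P? f f-inj with P? zero
... | no _ = count-≤-injection (P? ∘ suc) f (λ Pi Pj → suc-injective ∘ f-inj Pi Pj)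
count-≤-injection {n = suc n} {m = zero}  P? f f-inj | yes P0 = contradiction (f P0) ¬Fin0
count-≤-injection {n = suc n} {m = suc m} {P} P? f f-inj | yes P0 =
  s≤s (count-≤-injection (P? ∘ suc) (λ Pi → punchOut (f0≢ Pi))
        (λ Pi Pj eq → suc-injective (f-inj Pi Pj (punchOut-injective (f0≢ Pi) (f0≢ Pj) eq))))
  where
  f0≢ : ∀ {i} (Pi : P (suc i)) → f P0 ≢ f Pi
  f0≢ Pi eq with () ← f-inj P0 Pi eq

count-pairs-≤-injection : ∀ {m n k} {P : Pred (Fin m × Fin n) p} (P? : Decidable P)
                          (f : ∀ {ij} → P ij → Fin k) →
                          (∀ {ij ij'} (Pij : P ij) (Pij' : P ij') → f Pij ≡ f Pij' → ij ≡ ij') →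
                          count (P? ∘ remQuot n) ≤ k
count-pairs-≤-injection {m = m} {n} P? f f-inj =
  count-≤-injection (P? ∘ remQuot n) f λ {u} {u'} Pu Pu' eq →
    trans (sym (combine-remQuot {m} n u))
          (trans (cong (uncurry combine) (f-inj Pu Pu' eq)) (combine-remQuot {m} n u'))

injective⇒surjective : ∀ {n} {f : Fin n → Fin n} → Injective _≡_ _≡_ f → ∀ y → ∃ λ x → f x ≡ y
injective⇒surjective {zero}  f-inj ()
injective⇒surjective {suc n} {f} f-inj y with any? (λ x → f x ≟ y)
... | yes hit  = hit
... | no  miss = contradiction (injective⇒≤ skip-inj) 1+n≰n
  where
  y≢f : ∀ x → y ≢ f x
  y≢f x = miss ∘ (x ,_) ∘ sym
  skip-inj : Injective _≡_ _≡_ (λ x → punchOut (y≢f x))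
  skip-inj {x} {x'} eq = f-inj (punchOut-injective (y≢f x) (y≢f x') eq)

punchIn-avoiding : ∀ {p m} {g : Fin (suc p) → Fin m} → Injective _≡_ _≡_ g →
                   ∀ y → ∃ λ i → ∀ j → y ≢ g (punchIn i j)
punchIn-avoiding {g = g} g-inj y with any? (λ i → y ≟ g i)
... | yes (i , y≡gi) = i , λ j y≡g[i↑j] → punchInᵢ≢i i j (g-inj (trans (sym y≡g[i↑j]) y≡gi))
... | no  miss       = zero , λ j y≡g[0↑j] → miss (suc j , y≡g[0↑j])

orientation : ∀ {p} → Fin p → Fin p → Fin 2
orientation i k with i <? k
... | yes _ = zero
... | no  _ = suc zero

orientation-flip : ∀ {p} {i k : Fin p} → i ≢ k → orientation i k ≢ orientation k i
orientation-flip {i = i} {k} i≢k with i <? k | k <? i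
... | yes i<k | yes k<i = λ _ → <-asym i<k k<i
... | yes _   | no  _   = λ ()
... | no  _   | yes _   = λ ()
... | no  i≮k | no  k≮i = λ _ → i≢k (toℕ-injective (≤-antisym (≮⇒≥ k≮i) (≮⇒≥ i≮k)))

-- Rainbow cliques and lexicographic products

SameEdge : ∀ {q} → Fin q → Fin q → Fin q → Fin q → Set
SameEdge i j i' j' = (i ≡ i' × j ≡ j') ⊎ (i ≡ j' × j ≡ i')

IsRainbow : ∀ {n ℓ q} → (Fin n → Fin n → Fin ℓ) → (Fin q → Fin n) → Set
IsRainbow col f = ∀ {i j i' j'} → i ≢ j → i' ≢ j' →
                  col (f i) (f j) ≡ col (f i') (f j') → SameEdge i j i' j'

RainbowFree : ∀ {n ℓ} → EdgeColoring n ℓ → ℕ → Set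
RainbowFree {n} c q = (f : Fin q → Fin n) → Injective _≡_ _≡_ f → ¬ IsRainbow (col c) f

RainbowFree⇒¬RainbowClique : ∀ {n ℓ q} (c : EdgeColoring n ℓ) → RainbowFree c q → ¬ RainbowClique c q
RainbowFree⇒¬RainbowClique c free (f , f-inj , ordered) = free f f-inj rainbow
  where
  rainbow : IsRainbow (col c) f
  rainbow {i} {j} {i'} {j'} i≢j i'≢j' eq with <-cmp i j | <-cmp i' j'
  ... | tri≈ _ i≡j _ | _              = contradiction i≡j i≢j
  ... | _            | tri≈ _ i'≡j' _ = contradiction i'≡j' i'≢j'
  ... | tri< i<j _ _ | tri< i'<j' _ _ = inj₁ (ordered i j i' j' i<j i'<j' eq)
  ... | tri< i<j _ _ | tri> _ _ j'<i' =
    inj₂ (ordered i j j' i' i<j j'<i' (trans eq (EdgeColoring.sym c (f i') (f j'))))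
  ... | tri> _ _ j<i | tri< i'<j' _ _ =
    let (j≡i' , i≡j') = ordered j i i' j' j<i i'<j' (trans (EdgeColoring.sym c (f j) (f i)) eq)
    in inj₂ (i≡j' , j≡i')
  ... | tri> _ _ j<i | tri> _ _ j'<i' =
    let (j≡j' , i≡i') = ordered j i j' i' j<i j'<i'
                          (trans (EdgeColoring.sym c (f j) (f i)) (trans eq (EdgeColoring.sym c (f i') (f j'))))
    in inj₁ (i≡i' , j≡j')

colorDegree≡count : ∀ {n ℓ} (c : EdgeColoring n ℓ) v a →
                    colorDegree c v a ≡ count (λ u → ¬? (u ≟ v) ×-dec (col c v u ≟ a))
colorDegree≡count c v a = length-filter-tabulate (λ u → ¬? (u ≟ v) ×-dec (col c v u ≟ a)) (λ u → u)

module _ {L N ℓ} (B : EdgeColoring L ℓ) (c : EdgeColoring N ℓ) where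

  lexCol : Fin L × Fin N → Fin L × Fin N → Fin ℓ
  lexCol (x , w) (x' , w') with x ≟ x'
  ... | yes _ = col c w w'
  ... | no  _ = col B x x'

  lexCol-same : ∀ {x x' w w'} → x ≡ x' → lexCol (x , w) (x' , w') ≡ col c w w'
  lexCol-same {x} {x'} x≡x' with x ≟ x'
  ... | yes _    = refl
  ... | no  x≢x' = contradiction x≡x' x≢x'

  lexCol-other : ∀ {x x' w w'} → x ≢ x' → lexCol (x , w) (x' , w') ≡ col B x x'
  lexCol-other {x} {x'} x≢x' with x ≟ x'
  ... | yes x≡x' = contradiction x≡x' x≢x'
  ... | no  _    = refl

  lexCol-sym : ∀ u v → lexCol u v ≡ lexCol v u
  lexCol-sym (x , w) (x' , w') with x ≟ x'
  ... | yes x≡x' = trans (EdgeColoring.sym c w w') (sym (lexCol-same (sym x≡x')))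
  ... | no  x≢x' = trans (EdgeColoring.sym B x x') (sym (lexCol-other (x≢x' ∘ sym)))

  -- Vertex combine x w of the product is vertex w of the x-th copy of c; two copies are joined
  -- by the colour their indices receive in B.
  _⊗_ : EdgeColoring (L * N) ℓ
  _⊗_ = record
    { col = λ u v → lexCol (remQuot {L} N u) (remQuot {L} N v)
    ; sym = λ u v → lexCol-sym (remQuot {L} N u) (remQuot {L} N v)
    }

  block : Fin (L * N) → Fin L
  block = quotient N

  position : Fin (L * N) → Fin N
  position = remainder {L} N

  col-⊗-same : ∀ {u v} → block u ≡ block v → col _⊗_ u v ≡ col c (position u) (position v)
  col-⊗-same = lexCol-same

  col-⊗-other : ∀ {u v} → block u ≢ block v → col _⊗_ u v ≡ col B (block u) (block v)
  col-⊗-other = lexCol-other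

  block-combine : ∀ x w → block (combine x w) ≡ x
  block-combine x w = cong proj₁ (remQuot-combine {L} {N} x w)

  position-combine : ∀ x w → position (combine x w) ≡ w
  position-combine x w = cong proj₂ (remQuot-combine {L} {N} x w)

  combine-block-position : ∀ u → combine (block u) (position u) ≡ u
  combine-block-position = combine-remQuot {L} N

  module _ (v : Fin (L * N)) (a : Fin ℓ) where

    private
      X = block v
      W = position v

    Edge? : ∀ u → Dec (u ≢ v × col _⊗_ v u ≡ a)
    Edge? u = ¬? (u ≟ v) ×-dec (col _⊗_ v u ≟ a)

    count-own-block : count (λ (w : Fin N) → Edge? (combine X w)) ≡ colorDegree c W a
    count-own-block = trans (count-cong _ _ to from) (sym (colorDegree≡count c W a))
      where
      col≡ : ∀ w → col _⊗_ v (combine X w) ≡ col c W w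
      col≡ w = trans (col-⊗-same (sym (block-combine X w))) (cong (col c W) (position-combine X w))
      to : ∀ w → combine X w ≢ v × col _⊗_ v (combine X w) ≡ a → w ≢ W × col c W w ≡ a
      to w (≢v , ≡a) = (λ w≡W → ≢v (trans (cong (combine X) w≡W) (combine-block-position v))) ,
                       trans (sym (col≡ w)) ≡a
      from : ∀ w → w ≢ W × col c W w ≡ a → combine X w ≢ v × col _⊗_ v (combine X w) ≡ a
      from w (≢W , ≡a) = (λ eq → ≢W (trans (sym (position-combine X w)) (cong position eq))) ,
                         trans (col≡ w) ≡a

    count-other-block : ∀ {x} → x ≢ X →
                        count (λ (w : Fin N) → Edge? (combine x w)) ≡ N * indicator (col B X x ≟ a)
    count-other-block {x} x≢X = trans (count-cong _ (λ _ → col B X x ≟ a) to from) (count-const N _)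
      where
      other : ∀ w → block v ≢ block (combine x w)
      other w eq = x≢X (trans (sym (block-combine x w)) (sym eq))
      col≡ : ∀ w → col _⊗_ v (combine x w) ≡ col B X x
      col≡ w = trans (col-⊗-other (other w)) (cong (col B X) (block-combine x w))
      to : ∀ w → combine x w ≢ v × col _⊗_ v (combine x w) ≡ a → col B X x ≡ a
      to w (_ , ≡a) = trans (sym (col≡ w)) ≡a
      from : ∀ w → col B X x ≡ a → combine x w ≢ v × col _⊗_ v (combine x w) ≡ a
      from w ≡a = (λ eq → other w (cong block (sym eq))) , trans (col≡ w) ≡a

    count-block : ∀ x (x≟X : Dec (x ≡ X)) → count (λ (w : Fin N) → Edge? (combine x w)) ≡
                  indicator (¬? x≟X ×-dec (col B X x ≟ a)) * N + indicator x≟X * colorDegree c W a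
    count-block x (yes refl) = trans count-own-block (sym (*-identityˡ _))
    count-block x (no x≢X)   = begin
      count (λ (w : Fin N) → Edge? (combine x w))                   ≡⟨ count-other-block x≢X ⟩
      N * indicator (col B X x ≟ a)                       ≡⟨ *-comm N _ ⟩
      indicator (col B X x ≟ a) * N
        ≡⟨ cong (_* N) (indicator-cong (x≢X ,_) proj₂ (col B X x ≟ a) EdgeB?) ⟩
      indicator EdgeB? * N                                ≡⟨ +-identityʳ _ ⟨
      indicator EdgeB? * N + 0                            ∎
      where
      open ≡-Reasoning
      EdgeB? = ¬? (no x≢X) ×-dec (col B X x ≟ a)

    colorDegree-⊗ : colorDegree _⊗_ v a ≡ colorDegree B X a * N + colorDegree c W a
    colorDegree-⊗ = begin
      colorDegree _⊗_ v a
        ≡⟨ colorDegree≡count _⊗_ v a ⟩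
      count Edge?
        ≡⟨ ∑-combine L {N} _ ⟩
      sum (λ (x : Fin L) → count (λ (w : Fin N) → Edge? (combine x w)))
        ≡⟨ sum-cong-≗ (λ x → count-block x (x ≟ X)) ⟩
      sum (λ (x : Fin L) → indicator (EdgeB? x) * N + indicator (x ≟ X) * d)
        ≡⟨ ∑-distrib-+ {L} _ _ ⟩
      sum (λ (x : Fin L) → indicator (EdgeB? x) * N) + sum (λ (x : Fin L) → indicator (x ≟ X) * d)
        ≡⟨ cong₂ _+_ (*-distribʳ-sum {L} N _) (*-distribʳ-sum {L} d _) ⟨
      count EdgeB? * N + count (_≟ X) * d
        ≡⟨ cong₂ (λ m n → m * N + n * d) (sym (colorDegree≡count B X a))
                 (count-unique (_≟ X) X refl (λ _ → id)) ⟩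
      colorDegree B X a * N + 1 * d
        ≡⟨ cong (colorDegree B X a * N +_) (*-identityˡ d) ⟩
      colorDegree B X a * N + d
        ∎
      where
      open ≡-Reasoning
      d = colorDegree c W a
      EdgeB? : ∀ x → Dec (x ≢ X × col B X x ≡ a)
      EdgeB? x = ¬? (x ≟ X) ×-dec (col B X x ≟ a)

  module _ {q} {f : Fin q → Fin (L * N)}
           (f-inj : Injective _≡_ _≡_ f) (rainbow : IsRainbow (col _⊗_) f) where

    rainbow-across-blocks : Injective _≡_ _≡_ (block ∘ f) → IsRainbow (col B) (block ∘ f)
    rainbow-across-blocks block-inj i≢j i'≢j' eq =
      rainbow i≢j i'≢j'
        (trans (col-⊗-other (i≢j ∘ block-inj)) (trans eq (sym (col-⊗-other (i'≢j' ∘ block-inj)))))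

    rainbow-in-one-block : (∀ i j → block (f i) ≡ block (f j)) →
                           Injective _≡_ _≡_ (position ∘ f) × IsRainbow (col c) (position ∘ f)
    rainbow-in-one-block same = position-inj , position-rainbow
      where
      position-inj : Injective _≡_ _≡_ (position ∘ f)
      position-inj {i} {j} eq = f-inj (begin
        f i                                       ≡⟨ combine-block-position (f i) ⟨
        combine (block (f i)) (position (f i))    ≡⟨ cong₂ combine (same i j) eq ⟩
        combine (block (f j)) (position (f j))    ≡⟨ combine-block-position (f j) ⟩
        f j                                       ∎)
        where open ≡-Reasoning
      position-rainbow : IsRainbow (col c) (position ∘ f)
      position-rainbow {i} {j} {i'} {j'} i≢j i'≢j' eq =
        rainbow i≢j i'≢j' (trans (col-⊗-same (same i j)) (trans eq (sym (col-⊗-same (same i' j')))))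

    -- Two vertices i, j of one block and a vertex z of another block span the edges {i, z} and {j, z},
    -- both coloured col B (block i) (block z).
    one-block-only : ∀ {i j} → i ≢ j → block (f i) ≡ block (f j) → ∀ z → block (f z) ≡ block (f i)
    one-block-only {i} {j} i≢j same z with block (f z) ≟ block (f i)
    ... | yes same-block = same-block
    ... | no other-block = ⊥-elim ([ i≢j ∘ proj₁ , i≢z ∘ proj₁ ]′ (rainbow i≢z j≢z equal-colours))
      where
      i≢z : i ≢ z
      i≢z i≡z = other-block (cong (block ∘ f) (sym i≡z))
      j≢z : j ≢ z
      j≢z j≡z = other-block (trans (cong (block ∘ f) (sym j≡z)) (sym same))
      equal-colours : col _⊗_ (f i) (f z) ≡ col _⊗_ (f j) (f z)
      equal-colours = begin
        col _⊗_ (f i) (f z)               ≡⟨ col-⊗-other (other-block ∘ sym) ⟩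
        col B (block (f i)) (block (f z)) ≡⟨ cong (λ x → col B x (block (f z))) same ⟩
        col B (block (f j)) (block (f z)) ≡⟨ col-⊗-other (other-block ∘ sym ∘ trans same) ⟨
        col _⊗_ (f j) (f z)               ∎
        where open ≡-Reasoning

  ⊗-rainbowFree : ∀ {q} → RainbowFree B q → RainbowFree c q → RainbowFree _⊗_ q
  ⊗-rainbowFree B-free c-free f f-inj rainbow
    with any? (λ i → any? (λ j → ¬? (i ≟ j) ×-dec (block (f i) ≟ block (f j))))
  ... | no separated = B-free (block ∘ f) block-inj (rainbow-across-blocks f-inj rainbow block-inj)
    where
    block-inj : Injective _≡_ _≡_ (block ∘ f)
    block-inj {i} {j} same with i ≟ j
    ... | yes i≡j = i≡j
    ... | no  i≢j = contradiction (i , j , i≢j , same) separated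
  ... | yes (i , j , i≢j , same) = c-free (position ∘ f) (proj₁ one-block) (proj₂ one-block)
    where
    one-block = rainbow-in-one-block f-inj rainbow λ z z' →
      trans (one-block-only f-inj rainbow i≢j same z) (sym (one-block-only f-inj rainbow i≢j same z'))

[m∸1]*n+[n∸1]≡m*n∸1 : ∀ m n .{{_ : NonZero m}} → (m ∸ 1) * n + (n ∸ 1) ≡ m * n ∸ 1
[m∸1]*n+[n∸1]≡m*n∸1 (suc m) zero    rewrite *-zeroʳ m = refl
[m∸1]*n+[n∸1]≡m*n∸1 (suc m) (suc n) = +-comm (m * suc n) n

⊗-completelyBalanced : ∀ {L N ℓ} .{{_ : NonZero L}} {B : EdgeColoring L ℓ} {c : EdgeColoring N ℓ} →
                       CompletelyBalanced B → CompletelyBalanced c → CompletelyBalanced (B ⊗ c)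
⊗-completelyBalanced {L} {N} {ℓ} {B} {c} (e , ℓe≡L∸1 , deg-B) (d , ℓd≡N∸1 , deg-c) =
  e * N + d , size , λ v a → trans (colorDegree-⊗ B c v a) (cong₂ _+_ (cong (_* N) (deg-B _ a)) (deg-c _ a))
  where
  open ≡-Reasoning
  size : ℓ * (e * N + d) ≡ L * N ∸ 1
  size = begin
    ℓ * (e * N + d)          ≡⟨ *-distribˡ-+ ℓ (e * N) d ⟩
    ℓ * (e * N) + ℓ * d      ≡⟨ cong (_+ ℓ * d) (*-assoc ℓ e N) ⟨
    ℓ * e * N + ℓ * d        ≡⟨ cong₂ (λ x y → x * N + y) ℓe≡L∸1 ℓd≡N∸1 ⟩
    (L ∸ 1) * N + (N ∸ 1)    ≡⟨ [m∸1]*n+[n∸1]≡m*n∸1 L N ⟩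
    L * N ∸ 1                ∎

point : ∀ {ℓ} → EdgeColoring 1 (suc ℓ)
point = record { col = λ _ _ → zero ; sym = λ _ _ → refl }

point-completelyBalanced : ∀ {ℓ} → CompletelyBalanced (point {ℓ})
point-completelyBalanced {ℓ} = 0 , *-zeroʳ (suc ℓ) , λ { zero a → refl }

point-rainbowFree : ∀ {ℓ q} → 2 ≤ q → RainbowFree (point {ℓ}) q
point-rainbowFree 2≤q f f-inj _ = <⇒≱ 2≤q (injective⇒≤ f-inj)

power : ∀ {L ℓ} → EdgeColoring L (suc ℓ) → ∀ k → EdgeColoring (L ^ k) (suc ℓ)
power B zero    = point
power B (suc k) = B ⊗ power B k

power-completelyBalanced : ∀ {L ℓ} .{{_ : NonZero L}} {B : EdgeColoring L (suc ℓ)} →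
                           CompletelyBalanced B → ∀ k → CompletelyBalanced (power B k)
power-completelyBalanced B-balanced zero    = point-completelyBalanced
power-completelyBalanced B-balanced (suc k) =
  ⊗-completelyBalanced B-balanced (power-completelyBalanced B-balanced k)

power-rainbowFree : ∀ {L ℓ q} {B : EdgeColoring L (suc ℓ)} →
                    2 ≤ q → RainbowFree B q → ∀ k → RainbowFree (power B k) q
power-rainbowFree 2≤q B-free zero    = point-rainbowFree 2≤q
power-rainbowFree 2≤q B-free (suc k) = ⊗-rainbowFree _ _ B-free (power-rainbowFree 2≤q B-free k)

-- Residues modulo an odd number

module _ {d} .{{_ : NonZero d}} where

  %-cong-+ʳ : ∀ m n o → m % d ≡ n % d → (m + o) % d ≡ (n + o) % d
  %-cong-+ʳ m n o eq = begin
    (m + o) % d               ≡⟨ %-distribˡ-+ m o d ⟩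
    (m % d + o % d) % d       ≡⟨ cong (λ x → (x + o % d) % d) eq ⟩
    (n % d + o % d) % d       ≡⟨ %-distribˡ-+ n o d ⟨
    (n + o) % d               ∎
    where open ≡-Reasoning

  %-cong-*ʳ : ∀ m n o → m % d ≡ n % d → (m * o) % d ≡ (n * o) % d
  %-cong-*ʳ m n o eq = begin
    (m * o) % d               ≡⟨ %-distribˡ-* m o d ⟩
    (m % d * (o % d)) % d     ≡⟨ cong (λ x → (x * (o % d)) % d) eq ⟩
    (n % d * (o % d)) % d     ≡⟨ %-distribˡ-* n o d ⟨
    (n * o) % d               ∎
    where open ≡-Reasoning

%-cancel-+ˡ : ∀ {d} m {n o} → (m + n) % suc d ≡ (m + o) % suc d → n % suc d ≡ o % suc d
%-cancel-+ˡ {d} m {n} {o} eq = begin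
  n % suc d                        ≡⟨ [m+kn]%n≡m%n n m (suc d) ⟨
  (n + m * suc d) % suc d          ≡⟨ cong (_% suc d) (shift n m d) ⟩
  (m + n + m * d) % suc d          ≡⟨ %-cong-+ʳ (m + n) (m + o) (m * d) eq ⟩
  (m + o + m * d) % suc d          ≡⟨ cong (_% suc d) (shift o m d) ⟨
  (o + m * suc d) % suc d          ≡⟨ [m+kn]%n≡m%n o m (suc d) ⟩
  o % suc d                        ∎
  where
  open ≡-Reasoning
  shift : ∀ x m d → x + m * suc d ≡ m + x + m * d
  shift = solve-∀

module OddCyclic (s : ℕ) where

  ℓ : ℕ
  ℓ = suc (s + s)

  _⊕_ : Fin ℓ → Fin ℓ → Fin ℓ
  a ⊕ b = (toℕ a + toℕ b) mod ℓ

  _⊖_ : Fin ℓ → Fin ℓ → Fin ℓ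
  a ⊖ b = (toℕ a + (ℓ ∸ toℕ b)) mod ℓ

  private
    mod≡⇒%≡ : ∀ m n → m mod ℓ ≡ n mod ℓ → m % ℓ ≡ n % ℓ
    mod≡⇒%≡ _ _ eq = trans (sym (toℕ-fromℕ< _)) (trans (cong toℕ eq) (toℕ-fromℕ< _))

    %≡⇒mod≡ : ∀ m n → m % ℓ ≡ n % ℓ → m mod ℓ ≡ n mod ℓ
    %≡⇒mod≡ _ _ eq = toℕ-injective (trans (toℕ-fromℕ< _) (trans eq (sym (toℕ-fromℕ< _))))

    %≡⇒≡ : ∀ {a b : Fin ℓ} → toℕ a % ℓ ≡ toℕ b % ℓ → a ≡ b
    %≡⇒≡ {a} {b} eq = toℕ-injective (trans (sym (m<n⇒m%n≡m (toℕ<n a))) (trans eq (m<n⇒m%n≡m (toℕ<n b))))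

  ⊕-comm : ∀ a b → a ⊕ b ≡ b ⊕ a
  ⊕-comm a b = cong (_mod ℓ) (+-comm (toℕ a) (toℕ b))

  ⊕-cancelˡ : ∀ a b c → a ⊕ b ≡ a ⊕ c → b ≡ c
  ⊕-cancelˡ a b c eq = %≡⇒≡ (%-cancel-+ˡ (toℕ a) (mod≡⇒%≡ (toℕ a + toℕ b) (toℕ a + toℕ c) eq))

  -- Doubling is invertible modulo the odd number ℓ: (s + 1) * 2 ≡ 1 (mod ℓ).
  ⊕-double-injective : ∀ a b → a ⊕ a ≡ b ⊕ b → a ≡ b
  ⊕-double-injective a b eq = %≡⇒≡ (begin
    A % ℓ                    ≡⟨ halve A ⟩
    ((A + A) * suc s) % ℓ    ≡⟨ %-cong-*ʳ (A + A) (B + B) (suc s) (mod≡⇒%≡ (A + A) (B + B) eq) ⟩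
    ((B + B) * suc s) % ℓ    ≡⟨ halve B ⟨
    B % ℓ                    ∎)
    where
    open ≡-Reasoning
    A = toℕ a; B = toℕ b
    ring : ∀ m s → m + m * suc (s + s) ≡ (m + m) * suc s
    ring = solve-∀
    halve : ∀ m → m % ℓ ≡ ((m + m) * suc s) % ℓ
    halve m = trans (sym ([m+kn]%n≡m%n m m ℓ)) (cong (_% ℓ) (ring m s))

  ⊖-≡⇒⊕-≡ : ∀ a b a' b' → a ⊖ b ≡ a' ⊖ b' → a ⊕ b' ≡ a' ⊕ b
  ⊖-≡⇒⊕-≡ a b a' b' eq = %≡⇒mod≡ (A + B') (A' + B) (begin
    (A + B') % ℓ                        ≡⟨ [m+n]%n≡m%n (A + B') ℓ ⟨
    (A + B' + ℓ) % ℓ                    ≡⟨ cong (_% ℓ) (add-back A b B') ⟨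
    (A + (ℓ ∸ B) + (B + B')) % ℓ        ≡⟨ %-cong-+ʳ (A + (ℓ ∸ B)) (A' + (ℓ ∸ B')) (B + B') differences ⟩
    (A' + (ℓ ∸ B') + (B + B')) % ℓ      ≡⟨ cong (λ k → (A' + (ℓ ∸ B') + k) % ℓ) (+-comm B B') ⟩
    (A' + (ℓ ∸ B') + (B' + B)) % ℓ      ≡⟨ cong (_% ℓ) (add-back A' b' B) ⟩
    (A' + B + ℓ) % ℓ                    ≡⟨ [m+n]%n≡m%n (A' + B) ℓ ⟩
    (A' + B) % ℓ                        ∎)
    where
    open ≡-Reasoning
    A = toℕ a; B = toℕ b; A' = toℕ a'; B' = toℕ b'
    differences = mod≡⇒%≡ (A + (ℓ ∸ B)) (A' + (ℓ ∸ B')) eq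
    ring : ∀ m n k x → m + x + (n + k) ≡ m + k + (x + n)
    ring = solve-∀
    add-back : ∀ m (n : Fin ℓ) k → m + (ℓ ∸ toℕ n) + (toℕ n + k) ≡ m + k + ℓ
    add-back m n k = trans (ring m (toℕ n) k (ℓ ∸ toℕ n)) (cong (m + k +_) (m∸n+n≡m (<⇒≤ (toℕ<n n))))

  SumsDistinct : ∀ {p} → (Fin p → Fin ℓ) → Set
  SumsDistinct x = ∀ {i j i' j'} → i ≢ j → i' ≢ j' → x i ⊕ x j ≡ x i' ⊕ x j' → SameEdge i j i' j'

  module _ {p} {x : Fin p → Fin ℓ} (x-inj : Injective _≡_ _≡_ x) (distinct : SumsDistinct x) where

    Midpoint : Fin p × Fin p → Set
    Midpoint (i , j) = ∃ λ k → k ≢ i × x i ⊕ x k ≡ x j ⊕ x j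

    Midpoint? : ∀ ij → Dec (Midpoint ij)
    Midpoint? (i , j) = any? (λ k → ¬? (k ≟ i) ×-dec (x i ⊕ x k ≟ x j ⊕ x j))

    Generic : Fin p × Fin p → Set
    Generic (i , j) = i ≢ j × ¬ Midpoint (i , j)

    Generic? : ∀ ij → Dec (Generic ij)
    Generic? (i , j) = ¬? (i ≟ j) ×-dec ¬? (Midpoint? (i , j))

    Diagonal? : ∀ (ij : Fin p × Fin p) → Dec (proj₁ ij ≡ proj₂ ij)
    Diagonal? (i , j) = i ≟ j

    -- {i, j'} and {i', j} are edges of equal sum unless one of them degenerates to a point,
    -- which is exactly the midpoint situation.
    generic-cross-sums : ∀ {i j i' j'} → Generic (i , j) → Generic (i' , j') →
                         x i ⊕ x j' ≡ x i' ⊕ x j → (i , j) ≡ (i' , j')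
    generic-cross-sums {i} {j} {i'} {j'} (i≢j , ¬mid) (i'≢j' , ¬mid') sums with i' ≟ j | i ≟ j'
    ... | yes refl | _        = contradiction (j' , j'≢i , sums) ¬mid
      where
      j'≢i : j' ≢ i
      j'≢i refl = i≢j (x-inj (⊕-double-injective (x i) (x j) sums))
    ... | no i'≢j  | yes refl = contradiction (j , i'≢j ∘ sym , sym sums) ¬mid'
    ... | no i'≢j  | no i≢j'  with distinct i≢j' i'≢j sums
    ...   | inj₁ (i≡i' , j'≡j) = cong₂ _,_ i≡i' (sym j'≡j)
    ...   | inj₂ (i≡j , _)     = contradiction i≡j i≢j

    generic-injective : ∀ {i j i' j'} → Generic (i , j) → Generic (i' , j') →
                        x i ⊖ x j ≡ x i' ⊖ x j' → (i , j) ≡ (i' , j')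
    generic-injective {i} {j} {i'} {j'} gen gen' eq =
      generic-cross-sums gen gen' (⊖-≡⇒⊕-≡ (x i) (x j) (x i') (x j') eq)

    -- Only one edge has sum x j ⊕ x j, and the orientation tells its two endpoints apart.
    midpoint-injective : ∀ {i i' j} ((k , _) : Midpoint (i , j)) ((k' , _) : Midpoint (i' , j)) →
                         orientation i k ≡ orientation i' k' → i ≡ i'
    midpoint-injective (k , k≢i , sum) (k' , k'≢i' , sum') same
      with distinct (k≢i ∘ sym) (k'≢i' ∘ sym) (trans sum (sym sum'))
    ... | inj₁ (i≡i' , _)        = i≡i'
    ... | inj₂ (refl , refl)     = contradiction same (orientation-flip (k≢i ∘ sym))

    sumsDistinct-bound : p * p ≤ p + (2 * p + ℓ)
    sumsDistinct-bound = begin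
      p * p
        ≡⟨ count-universal (all? ∘ remQuot p) (cover ∘ remQuot p) ⟨
      count (all? ∘ remQuot p)
        ≤⟨ count-∪ (Diagonal? ∘ remQuot p) _ ⟩
      count (Diagonal? ∘ remQuot p) + count (rest? ∘ remQuot p)
        ≤⟨ +-monoʳ-≤ _ (count-∪ (Midpoint? ∘ remQuot p) _) ⟩
      count (Diagonal? ∘ remQuot p) + (count (Midpoint? ∘ remQuot p) + count (Generic? ∘ remQuot p))
        ≤⟨ +-mono-≤ diagonal (+-mono-≤ midpoint generic) ⟩
      p + (2 * p + ℓ)
        ∎
      where
      open ≤-Reasoning
      rest? = Midpoint? ∪? Generic?
      all? = Diagonal? ∪? rest?

      cover : ∀ ij → _
      cover (i , j) with i ≟ j | Midpoint? (i , j)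
      ... | yes i≡j | _        = inj₁ i≡j
      ... | no  _   | yes mid  = inj₂ (inj₁ mid)
      ... | no  i≢j | no  ¬mid = inj₂ (inj₂ (i≢j , ¬mid))

      diagonal : count (Diagonal? ∘ remQuot p) ≤ p
      diagonal = count-pairs-≤-injection Diagonal? (λ {(i , _)} _ → i) λ { refl refl refl → refl }

      midpoint : count (Midpoint? ∘ remQuot p) ≤ 2 * p
      midpoint = count-pairs-≤-injection Midpoint? code code-injective
        where
        code : ∀ {ij} → Midpoint ij → Fin (2 * p)
        code {i , j} (k , _) = combine (orientation i k) j
        code-injective : ∀ {ij ij'} (m : Midpoint ij) (m' : Midpoint ij') → code m ≡ code m' → ij ≡ ij'
        code-injective {i , j} {i' , j'} m@(k , _) m'@(k' , _) eq
          with combine-injective (orientation i k) j (orientation i' k') j' eq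
        ... | same , refl = cong (_, j) (midpoint-injective m m' same)

      generic : count (Generic? ∘ remQuot p) ≤ ℓ
      generic = count-pairs-≤-injection Generic? (λ {(i , j)} _ → x i ⊖ x j) generic-injective

  -- Vertex zero plays the point at infinity and suc a the residue a; the colour classes are the
  -- perfect matchings {a, b} with a + b ≡ c together with {∞, c / 2} (the classical GK_(ℓ+1)).
  factor : Fin (suc ℓ) → Fin (suc ℓ) → Fin ℓ
  factor zero    zero    = zero
  factor zero    (suc b) = b ⊕ b
  factor (suc a) zero    = a ⊕ a
  factor (suc a) (suc b) = a ⊕ b

  factor-sym : ∀ u v → factor u v ≡ factor v u
  factor-sym zero    zero    = refl
  factor-sym zero    (suc b) = refl
  factor-sym (suc a) zero    = refl
  factor-sym (suc a) (suc b) = ⊕-comm a b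

  factor-injective : ∀ u {v v'} → v ≢ u → v' ≢ u → factor u v ≡ factor u v' → v ≡ v'
  factor-injective zero    {zero}            v≢u _    _  = contradiction refl v≢u
  factor-injective zero    {suc _} {zero}    _   v'≢u _  = contradiction refl v'≢u
  factor-injective zero    {suc b} {suc b'}  _   _    eq = cong suc (⊕-double-injective b b' eq)
  factor-injective (suc a) {zero}  {zero}    _   _    _  = refl
  factor-injective (suc a) {zero}  {suc b'}  _   v'≢u eq = contradiction (cong suc (sym (⊕-cancelˡ a a b' eq))) v'≢u
  factor-injective (suc a) {suc b} {zero}    v≢u _    eq = contradiction (cong suc (⊕-cancelˡ a b a eq)) v≢u
  factor-injective (suc a) {suc b} {suc b'}  _   _    eq = cong suc (⊕-cancelˡ a b b' eq)

  oneFactorization : EdgeColoring (suc ℓ) ℓ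
  oneFactorization = record { col = factor ; sym = factor-sym }

  oneFactorization-completelyBalanced : CompletelyBalanced oneFactorization
  oneFactorization-completelyBalanced = 1 , *-identityʳ ℓ , degree-one
    where
    partner-inj : ∀ u → Injective _≡_ _≡_ (λ j → factor u (punchIn u j))
    partner-inj u eq = punchIn-injective u _ _ (factor-injective u (punchInᵢ≢i u _) (punchInᵢ≢i u _) eq)
    degree-one : ∀ u a → colorDegree oneFactorization u a ≡ 1
    degree-one u a with j , partner ← injective⇒surjective (partner-inj u) a =
      trans (colorDegree≡count oneFactorization u a)
            (count-unique (λ v → ¬? (v ≟ u) ×-dec (factor u v ≟ a)) (punchIn u j) (punchInᵢ≢i u j , partner) unique)
      where
      unique : ∀ v → v ≢ u × factor u v ≡ a → v ≡ punchIn u j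
      unique v (v≢u , colour) = factor-injective u v≢u (punchInᵢ≢i u j) (trans colour (sym partner))

  -- Dropping ∞ (or any vertex, if ∞ is not used) from a rainbow K_q leaves q - 1 residues with
  -- distinct pairwise sums.
  oneFactorization-rainbowFree : ∀ {q} → 9 ≤ q → 2 * ℓ ≡ q * (q ∸ 1) → RainbowFree oneFactorization q
  oneFactorization-rainbowFree {suc p} (s≤s 8≤p) 2ℓ≡q[q-1] g g-inj rainbow =
    contradiction p≤7 (<⇒≱ 8≤p)
    where
    skipped = punchIn-avoiding g-inj zero
    i₀ = proj₁ skipped
    x : Fin p → Fin ℓ
    x j = punchOut (proj₂ skipped j)
    g≡suc-x : ∀ j → g (punchIn i₀ j) ≡ suc (x j)
    g≡suc-x j = sym (punchIn-punchOut (proj₂ skipped j))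
    x-inj : Injective _≡_ _≡_ x
    x-inj {i} {j} eq =
      punchIn-injective i₀ i j (g-inj (trans (g≡suc-x i) (trans (cong suc eq) (sym (g≡suc-x j)))))
    distinct : SumsDistinct x
    distinct {i} {j} {i'} {j'} i≢j i'≢j' eq =
      Sum.map (Product.map inj inj) (Product.map inj inj)
        (rainbow (i≢j ∘ inj) (i'≢j' ∘ inj) (begin
          factor (g (punchIn i₀ i)) (g (punchIn i₀ j))     ≡⟨ cong₂ factor (g≡suc-x i) (g≡suc-x j) ⟩
          x i ⊕ x j                                         ≡⟨ eq ⟩
          x i' ⊕ x j'                                       ≡⟨ cong₂ factor (g≡suc-x i') (g≡suc-x j') ⟨
          factor (g (punchIn i₀ i')) (g (punchIn i₀ j'))   ∎))
      where
      open ≡-Reasoning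
      inj : ∀ {a b} → punchIn i₀ a ≡ punchIn i₀ b → a ≡ b
      inj = punchIn-injective i₀ _ _
    p≤7 : p ≤ 7
    p≤7 = *-cancelʳ-≤ p 7 p {{>-nonZero (≤-trans (s≤s z≤n) 8≤p)}} (+-cancelʳ-≤ (p * p) (p * p) (7 * p) (begin
      p * p + p * p                              ≤⟨ +-mono-≤ bound bound ⟩
      (p + (2 * p + ℓ)) + (p + (2 * p + ℓ))      ≡⟨ double p ℓ ⟩
      6 * p + 2 * ℓ                              ≡⟨ cong (6 * p +_) 2ℓ≡q[q-1] ⟩
      6 * p + suc p * p                          ≡⟨ expand p ⟩
      7 * p + p * p                              ∎))
      where
      open ≤-Reasoning
      bound = sumsDistinct-bound x-inj distinct
      double : ∀ p l → (p + (2 * p + l)) + (p + (2 * p + l)) ≡ 6 * p + 2 * l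
      double = solve-∀
      expand : ∀ p → 6 * p + suc p * p ≡ 7 * p + p * p
      expand = solve-∀

2*[nC2]≡n*[n∸1] : ∀ n → 2 * (n C 2) ≡ n * (n ∸ 1)
2*[nC2]≡n*[n∸1] zero          = refl
2*[nC2]≡n*[n∸1] (suc zero)    = refl
2*[nC2]≡n*[n∸1] (suc (suc n)) = begin
  2 * (suc (suc n) C 2)         ≡⟨ cong (2 *_) (nCk+nC[k+1]≡[n+1]C[k+1] (suc n) 1) ⟨
  2 * (suc n C 1 + suc n C 2)   ≡⟨ cong (λ m → 2 * (m + suc n C 2)) (nC1≡n (suc n)) ⟩
  2 * (suc n + suc n C 2)       ≡⟨ *-distribˡ-+ 2 (suc n) (suc n C 2) ⟩
  2 * suc n + 2 * (suc n C 2)   ≡⟨ cong (2 * suc n +_) (2*[nC2]≡n*[n∸1] (suc n)) ⟩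
  2 * suc n + suc n * n         ≡⟨ ring n ⟩
  suc (suc n) * suc n           ∎
  where
  open ≡-Reasoning
  ring : ∀ n → 2 * suc n + suc n * n ≡ suc (suc n) * suc n
  ring = solve-∀

nC2≡ : ∀ n {m} → 2 * m ≡ n * (n ∸ 1) → n C 2 ≡ m
nC2≡ n {m} eq = *-cancelˡ-≡ (n C 2) m 2 (trans (2*[nC2]≡n*[n∸1] n) (sym eq))

n≡n%4+[n/4]*4 : ∀ n {r} → n % 4 ≡ r → n ≡ r + n / 4 * 4
n≡n%4+[n/4]*4 n n%4≡r = trans (m≡m%n+[m/n]*n n 4) (cong (_+ n / 4 * 4) n%4≡r)

nC2-odd : ∀ n → n % 4 ≡ 2 ⊎ n % 4 ≡ 3 → ∃ λ s → n C 2 ≡ suc (s + s)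
nC2-odd n (inj₁ n%4≡2) = s , nC2≡ n (begin
  2 * suc (s + s)              ≡⟨ ring t ⟩
  (2 + t * 4) * (1 + t * 4)    ≡⟨ cong (λ m → m * (m ∸ 1)) (n≡n%4+[n/4]*4 n n%4≡2) ⟨
  n * (n ∸ 1)                  ∎)
  where
  open ≡-Reasoning
  t = n / 4
  s = 4 * (t * t) + 3 * t
  ring : ∀ t → 2 * suc (4 * (t * t) + 3 * t + (4 * (t * t) + 3 * t)) ≡ (2 + t * 4) * (1 + t * 4)
  ring = solve-∀
nC2-odd n (inj₂ n%4≡3) = s , nC2≡ n (begin
  2 * suc (s + s)              ≡⟨ ring t ⟩
  (3 + t * 4) * (2 + t * 4)    ≡⟨ cong (λ m → m * (m ∸ 1)) (n≡n%4+[n/4]*4 n n%4≡3) ⟨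
  n * (n ∸ 1)                  ∎)
  where
  open ≡-Reasoning
  t = n / 4
  s = 4 * (t * t) + 5 * t + 1
  ring : ∀ t → 2 * suc (4 * (t * t) + 5 * t + 1 + (4 * (t * t) + 5 * t + 1)) ≡ (3 + t * 4) * (2 + t * 4)
  ring = solve-∀

theorem2 : (q : ℕ) → q ≥ 10 → (q % 4 ≡ 2 ⊎ q % 4 ≡ 3) →
    (k : ℕ) → k ≥ 1 →
      Σ (EdgeColoring ((q C 2 + 1) ^ k) (q C 2)) λ c →
        CompletelyBalanced c × ¬ RainbowClique c q
theorem2 q q≥10 q%4 k _ with s , qC2≡ℓ ← nC2-odd q q%4 rewrite qC2≡ℓ | +-comm (suc (s + s)) 1 =
  power oneFactorization k ,
  power-completelyBalanced oneFactorization-completelyBalanced k ,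
  RainbowFree⇒¬RainbowClique (power oneFactorization k)
    (power-rainbowFree (≤-trans (s≤s (s≤s z≤n)) q≥10) (oneFactorization-rainbowFree 9≤q 2ℓ≡q[q∸1]) k)
  where
  open OddCyclic s
  9≤q : 9 ≤ q
  9≤q = ≤-trans (n≤1+n 9) q≥10
  2ℓ≡q[q∸1] : 2 * ℓ ≡ q * (q ∸ 1)
  2ℓ≡q[q∸1] = trans (cong (2 *_) (sym qC2≡ℓ)) (2*[nC2]≡n*[n∸1] q)
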